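{- Let $n\geq 3$ be odd and $j\geq 1$ an integer. Let $D_n=\langle r,s\mid r^n=s^2=1,\ srs=r^{ -1}\rangle$ be the dihedral group of order $2n$, $X=\{r,r^2,\ldots,r^{(n-1)/2},sr,sr^2,\ldots,sr^{(n-1)/2}\}$, and $\Gamma=\mathrm{Cay}(D_n,X)$. Then the partition $\pi=\{\{1,r,\ldots,r^{n-1}\},\{s,sr,\ldots,sr^{n-1}\}\}$ is a good partition for $\Gamma$, and there exists a directed strongly regular graph with parameter set $$\Big((4j+2)n,\; 2jn+n-1,\; jn+\tfrac{n-1}{2},\; jn+\tfrac{n-3}{2},\; jn+\tfrac{n-1}{2}\Big).$$
   Context: For a group $H$ and $X\subseteq H\setminus\{e\}$, the Cayley digraph $\mathrm{Cay}(H,X)$ has vertex set $H$ and arcs $x\to y$ iff $yx^{ -1}\in X$. A directed strongly regular graph (DSRG) with parameters $(n,k,t,\lambda,\mu)$ is a loopless digraph on $n$ vertices whose adjacency matrix $A$ satisfies $AJ=JA=kJ$ and $A^2=tI+\lambda A+\mu(J-I-A)$. The digraph $\Gamma$ is known (Klin et al.) to be a DSRG with parameters $(2n,n-1,\frac{n-1}2,\frac{n-3}2,\frac{n-1}2)$. For a homogeneous partition $\pi=\{C_1,\dots,C_a\}$ (all cells of equal size), the $\pi$-join $\Gamma^1_\pi$ has vertex set $V(\Gamma)\times\{0,\dots,a\}$ and arcs $(u,r)\to(v,r)$ whenever $u\to v$ in $\Gamma$, and, for every $(u,r)$ and every $i$, arcs from $(u,r)$ to all $(v,r+i\bmod (a+1))$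 with $v\in C_i$; $\pi$ is good for $\Gamma$ if $\Gamma^1_\pi$ is a DSRG. -}

module Defs where

open import Data.Nat using (ℕ; zero; suc; _+_; _*_; _∸_; _≤_; _%_; _/_; _≡ᵇ_; _≤ᵇ_; NonZero)
open import Data.Nat.DivMod using (_mod_)
open import Data.Bool using (Bool; true; false; if_then_else_; _∧_; _∨_)
open import Data.Fin using (Fin; toℕ) renaming (zero to fz; suc to fs)
open import Data.List using (List; []; _∷_; length; cartesianProductWith; allFin)
open import Data.Product using (_×_; _,_; Σ; ∃)
open import Relation.Binary.PropositionalEquality using (_≡_; _≢_)

countL : {V : Set} → List V → (V → Bool) → ℕ
countL [] p = 0
countL (x ∷ xs) p = (if p x then 1 else 0) + countL xs p

-- A digraph on the finite vertex type V, whose vertices are enumerated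
-- (each exactly once) by the list vs, with adjacency A (A x y = arc x → y).
-- DSRG(n,k,t,lam,mu): the matrix conditions AJ=JA=kJ and
-- A² = tI + lam A + mu(J - I - A), read entrywise; (A²)_{xy} = #{z | x→z→y}.
record IsDSRG {V : Set} (vs : List V) (A : V → V → Bool) (n k t lam mu : ℕ) : Set where
  field
    order     : length vs ≡ n
    loopless  : ∀ x → A x x ≡ false
    outReg    : ∀ x → countL vs (λ y → A x y) ≡ k
    inReg     : ∀ y → countL vs (λ x → A x y) ≡ k
    sqDiag    : ∀ x → countL vs (λ z → A x z ∧ A z x) ≡ t
    sqAdj     : ∀ x y → x ≢ y → A x y ≡ true → countL vs (λ z → A x z ∧ A z y) ≡ lam
    sqNonAdj  : ∀ x y → x ≢ y → A x y ≡ false → countL vs (λ z → A x z ∧ A z y) ≡ mu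

prodList : {U W : Set} → List U → List W → List (U × W)
prodList = cartesianProductWith _,_

Cay : {H : Set} → (H → H → H) → (H → H) → (H → Bool) → H → H → Bool
Cay mul inv inX x y = inX (mul y (inv x))

-- Dihedral group D_n: element (a , b) stands for s^a r^b  (a ∈ Z_2, b ∈ Z_n).
-- s^a r^b · s^c r^d = s^(a+c) r^((-1)^c b + d)   (using r^b s = s r^(-b))
Dih : ℕ → Set
Dih n = Fin 2 × Fin n

dihElems : (n : ℕ) → List (Dih n)
dihElems n = prodList (allFin 2) (allFin n)

negMod : (n : ℕ) .{{_ : NonZero n}} → Fin n → Fin n
negMod n b = (n ∸ toℕ b) mod n

dihMul : (n : ℕ) .{{_ : NonZero n}} → Dih n → Dih n → Dih n
dihMul n (a , b) (c , d) =
  ((toℕ a + toℕ c) mod 2 ,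
   ((toℕ (if toℕ c ≡ᵇ 0 then b else negMod n b) + toℕ d) mod n))

dihInv : (n : ℕ) .{{_ : NonZero n}} → Dih n → Dih n
dihInv n (fz , b) = (fz , negMod n b)
dihInv n (fs a , b) = (fs a , b)

inXDih : (n : ℕ) → Dih n → Bool
inXDih n (a , b) = (1 ≤ᵇ toℕ b) ∧ (toℕ b ≤ᵇ ((n ∸ 1) / 2))

GammaDih : (n : ℕ) .{{_ : NonZero n}} → Dih n → Dih n → Bool
GammaDih n = Cay (dihMul n) (dihInv n) (inXDih n)

-- A partition π = {C_1,…,C_a} of the vertex set is given by the cell map
-- cell : V → Fin a (cell v = i  means v ∈ C_(i+1)).
-- π-join Γ^1_π on V × {0,…,a}: (u,r) → (v,r) when u → v in Γ, and
-- (u,r) → (v, r + i mod (a+1)) for v ∈ C_i (i = 1..a).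
join : {V : Set} (a : ℕ) → (V → V → Bool) → (V → Fin a) → V × Fin (suc a) → V × Fin (suc a) → Bool
join a A cell (u , r) (v , r') =
  ((toℕ r ≡ᵇ toℕ r') ∧ A u v) ∨ (toℕ r' ≡ᵇ ((toℕ r + suc (toℕ (cell v))) % suc a))

IsGoodPartition : {V : Set} (vs : List V) (A : V → V → Bool) (a : ℕ) (cell : V → Fin a) → Set
IsGoodPartition vs A a cell =
  ((i : Fin a) → 1 ≤ countL vs (λ v → toℕ (cell v) ≡ᵇ toℕ i)) ×
  ((i j : Fin a) → countL vs (λ v → toℕ (cell v) ≡ᵇ toℕ i) ≡ countL vs (λ v → toℕ (cell v) ≡ᵇ toℕ j)) ×
  Σ ℕ (λ n → Σ ℕ (λ k → Σ ℕ (λ t → Σ ℕ (λ lam → Σ ℕ (λ mu →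
    IsDSRG (prodList vs (allFin (suc a))) (join a A cell) n k t lam mu)))))

piDih : (n : ℕ) → Dih n → Fin 2
piDih n (a , b) = a

ExistsDSRG : (n k t lam mu : ℕ) → Set
ExistsDSRG n k t lam mu = Σ ℕ (λ N → Σ (Fin N → Fin N → Bool) (λ A → IsDSRG (allFin N) A n k t lam mu))

module Submission where

-- Both claims are instances of one construction.  Let A be a
-- digraph on two cells Fin 2 × Fin n, n = 2m + 1, that is loopless, has
-- out-degree 2m, gives every vertex exactly m in-arcs from each cell, and
-- satisfies A² + A = mJ.  Take L layers and a layer relation ρ(r, s, c):
-- layer r sends arcs to all of cell c of layer s.  If ρ is irreflexive, links
-- two distinct layers through exactly one cell, and is j-regular in every
-- cell, then the layered digraph (A inside each layer, ρ across layers) is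
-- again loopless, regular, and satisfies A² + A = μJ with μ = m + nj; any
-- such digraph is a DSRG with t = μ and λ = μ - 1 (squareRegular⇒DSRG).

open import Defs
open import Data.Nat using (ℕ; zero; suc; _+_; _*_; _∸_; _≤_; _<_; _%_; _/_; _≡ᵇ_; _≤ᵇ_; NonZero; z≤n; s≤s)
open import Data.Nat.Properties
open import Data.Nat.DivMod using (_mod_; %-distribˡ-+; m%n%n≡m%n; [m+n]%n≡m%n; m<n⇒m%n≡m; n%n≡0; m%n<n; m*n/n≡m; m≡m%n+[m/n]*n)
open import Data.Nat.Solver using (module +-*-Solver)
open import Data.Bool using (Bool; true; false; if_then_else_; _∧_; _∨_; T)
open import Data.Bool.Properties using (∨-identityʳ)
open import Data.Fin using (Fin; toℕ) renaming (zero to fz; suc to fs)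
open import Data.Fin.Properties using (toℕ-fromℕ<; toℕ-injective; toℕ<n)
open import Data.Fin.Permutation using (permutation)
open import Data.List using (List; []; _∷_; _++_; map; tabulate; length; allFin; lookup)
open import Data.List.Properties using (length-++; length-map; length-tabulate; map-tabulate; tabulate-lookup)
open import Data.Product using (_×_; _,_; proj₁)
open import Data.Empty using (⊥-elim)
open import Data.Unit using (tt)
open import Function using (_∘_)
open import Relation.Binary.PropositionalEquality
open import Relation.Binary.Definitions using (tri<; tri≈; tri>)

open import Relation.Nullary.Reflects using (ofʸ; ofⁿ)
open import Algebra.Properties.Semiring.Sum +-*-semiring
  using (sum-syntax; sum-cong-≗; ∑-distrib-+; ∑-comm; ∑-permute; *-distribˡ-sum)

open +-*-Solver
open ≡-Reasoning

ind : Bool → ℕ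
ind b = if b then 1 else 0

ind-∧ : ∀ a b → ind (a ∧ b) ≡ ind a * ind b
ind-∧ true b = sym (+-identityʳ (ind b))
ind-∧ false b = refl

ind≡0 : ∀ {b} → ind b ≡ 0 → b ≡ false
ind≡0 {false} _ = refl

δ : ∀ {k} → Fin k → Fin k → ℕ
δ r s = ind (toℕ r ≡ᵇ toℕ s)

≡ᵇ-true : ∀ {k} {r s : Fin k} → (toℕ r ≡ᵇ toℕ s) ≡ true → r ≡ s
≡ᵇ-true {r = r} {s} e = toℕ-injective (≡ᵇ⇒≡ (toℕ r) (toℕ s) (subst T (sym e) tt))

≡ᵇ-false : ∀ {k} {r s : Fin k} → (toℕ r ≡ᵇ toℕ s) ≡ false → r ≢ s
≡ᵇ-false {r = r} e refl = subst T e (≡⇒≡ᵇ (toℕ r) (toℕ r) refl)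

sum-const : ∀ k c → ∑[ i < k ] c ≡ k * c
sum-const zero c = refl
sum-const (suc k) c = cong (c +_) (sum-const k c)

sum-zero : ∀ k → ∑[ i < k ] 0 ≡ 0
sum-zero k = trans (sum-const k 0) (*-zeroʳ k)

sum-delta : ∀ {k} (r : Fin k) (g : Fin k → ℕ) → ∑[ q < k ] (δ r q * g q) ≡ g r
sum-delta {suc k} fz g = trans (cong (g fz + 0 +_) (sum-zero k)) (trans (+-identityʳ _) (+-identityʳ _))
sum-delta {suc k} (fs r) g = sum-delta r (g ∘ fs)

sum-delta′ : ∀ {k} (s : Fin k) (g : Fin k → ℕ) → ∑[ q < k ] (δ q s * g q) ≡ g s
sum-delta′ {suc k} fz g = trans (cong (g fz + 0 +_) (sum-zero k)) (trans (+-identityʳ _) (+-identityʳ _))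
sum-delta′ {suc k} (fs s) g = sum-delta′ s (g ∘ fs)

sum-bijection : ∀ {k} (g h : Fin k → Fin k) → (∀ x → g (h x) ≡ x) → (∀ x → h (g x) ≡ x) →
  (f : Fin k → ℕ) → ∑[ i < k ] f (g i) ≡ ∑[ i < k ] f i
sum-bijection g h gh hg f = sym (∑-permute f (permutation g h gh hg))

sum-complement : ∀ {k} (r : Fin k) (c g : Fin k → ℕ) → (∀ q → δ r q + c q ≡ 1) →
  (∑[ q < k ] (c q * g q)) + g r ≡ ∑[ q < k ] g q
sum-complement {k} r c g link = begin
  (∑[ q < k ] (c q * g q)) + g r                     ≡⟨ cong ((∑[ q < k ] (c q * g q)) +_) (sum-delta r g) ⟨
  (∑[ q < k ] (c q * g q)) + (∑[ q < k ] (δ r q * g q)) ≡⟨ ∑-distrib-+ (λ q → c q * g q) (λ q → δ r q * g q) ⟨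
  ∑[ q < k ] (c q * g q + δ r q * g q)               ≡⟨ sum-cong-≗ weight-one ⟩
  ∑[ q < k ] g q                                     ∎
  where
  weight-one : ∀ q → c q * g q + δ r q * g q ≡ g q
  weight-one q = begin
    c q * g q + δ r q * g q ≡⟨ *-distribʳ-+ (g q) (c q) (δ r q) ⟨
    (c q + δ r q) * g q     ≡⟨ cong (_* g q) (trans (+-comm (c q) (δ r q)) (link q)) ⟩
    1 * g q                 ≡⟨ *-identityˡ (g q) ⟩
    g q                     ∎

sumL : {V : Set} → List V → (V → ℕ) → ℕ
sumL [] h = 0
sumL (x ∷ xs) h = h x + sumL xs h

countL-sumL : {V : Set} (xs : List V) (p : V → Bool) → countL xs p ≡ sumL xs (ind ∘ p)
countL-sumL [] p = refl
countL-sumL (x ∷ xs) p = cong (ind (p x) +_) (countL-sumL xs p)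

sumL-++ : {V : Set} (xs ys : List V) (h : V → ℕ) → sumL (xs ++ ys) h ≡ sumL xs h + sumL ys h
sumL-++ [] ys h = refl
sumL-++ (x ∷ xs) ys h = trans (cong (h x +_) (sumL-++ xs ys h)) (sym (+-assoc (h x) _ _))

sumL-map : {U V : Set} (f : U → V) (xs : List U) (h : V → ℕ) → sumL (map f xs) h ≡ sumL xs (h ∘ f)
sumL-map f [] h = refl
sumL-map f (x ∷ xs) h = cong (h (f x) +_) (sumL-map f xs h)

sumL-prod : {U V : Set} (xs : List U) (ys : List V) (h : U × V → ℕ) →
  sumL (prodList xs ys) h ≡ sumL xs (λ x → sumL ys (λ y → h (x , y)))
sumL-prod [] ys h = refl
sumL-prod (x ∷ xs) ys h = trans (sumL-++ (map (x ,_) ys) (prodList xs ys) h)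
  (cong₂ _+_ (sumL-map (x ,_) ys h) (sumL-prod xs ys h))

sumL-tabulate : {V : Set} → ∀ k (g : Fin k → V) (h : V → ℕ) → sumL (tabulate g) h ≡ ∑[ i < k ] h (g i)
sumL-tabulate zero g h = refl
sumL-tabulate (suc k) g h = cong (h (g fz) +_) (sumL-tabulate k (g ∘ fs) h)

sumL-allFin : ∀ k (h : Fin k → ℕ) → sumL (allFin k) h ≡ ∑[ i < k ] h i
sumL-allFin k = sumL-tabulate k (λ i → i)

countL-map : {U V : Set} (f : U → V) (xs : List U) (p : V → Bool) → countL (map f xs) p ≡ countL xs (p ∘ f)
countL-map f [] p = refl
countL-map f (x ∷ xs) p = cong (ind (p (f x)) +_) (countL-map f xs p)

countL-lookup : {V : Set} (vs : List V) (p : V → Bool) → countL (allFin (length vs)) (p ∘ lookup vs) ≡ countL vs p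
countL-lookup vs p = begin
  countL (allFin (length vs)) (p ∘ lookup vs)  ≡⟨ countL-map (lookup vs) (allFin (length vs)) p ⟨
  countL (map (lookup vs) (allFin (length vs))) p ≡⟨ cong (λ xs → countL xs p) (trans (map-tabulate (λ i → i) (lookup vs)) (tabulate-lookup vs)) ⟩
  countL vs p                                  ∎

length-prod : {U V : Set} (xs : List U) (ys : List V) → length (prodList xs ys) ≡ length xs * length ys
length-prod [] ys = refl
length-prod (x ∷ xs) ys = trans (length-++ (map (x ,_) ys)) (cong₂ _+_ (length-map (x ,_) ys) (length-prod xs ys))

ΣV : (n : ℕ) → (Dih n → ℕ) → ℕ
ΣV n f = ∑[ a < 2 ] ∑[ b < n ] f (a , b)

sumL-dih : ∀ n (h : Dih n → ℕ) → sumL (dihElems n) h ≡ ΣV n h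
sumL-dih n h = begin
  sumL (dihElems n) h                                   ≡⟨ sumL-prod (allFin 2) (allFin n) h ⟩
  sumL (allFin 2) (λ a → sumL (allFin n) (λ b → h (a , b))) ≡⟨ sumL-allFin 2 (λ a → sumL (allFin n) (λ b → h (a , b))) ⟩
  ∑[ a < 2 ] sumL (allFin n) (λ b → h (a , b))          ≡⟨ sum-cong-≗ (λ a → sumL-allFin n (λ b → h (a , b))) ⟩
  ΣV n h                                                ∎

countL-dih : ∀ n (p : Dih n → Bool) → countL (dihElems n) p ≡ ΣV n (ind ∘ p)
countL-dih n p = trans (countL-sumL (dihElems n) p) (sumL-dih n (ind ∘ p))

ΣV-+ : ∀ n (f g : Dih n → ℕ) → ΣV n (λ w → f w + g w) ≡ ΣV n f + ΣV n g
ΣV-+ n f g = trans (sum-cong-≗ (λ a → ∑-distrib-+ (λ b → f (a , b)) (λ b → g (a , b))))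
  (∑-distrib-+ (λ a → ∑[ b < n ] f (a , b)) (λ a → ∑[ b < n ] g (a , b)))

ΣV-* : ∀ n c (f : Dih n → ℕ) → ΣV n (λ w → c * f w) ≡ c * ΣV n f
ΣV-* n c f = sym (trans (*-distribˡ-sum c (λ a → ∑[ b < n ] f (a , b)))
  (sum-cong-≗ (λ a → *-distribˡ-sum c (λ b → f (a , b)))))

ΣV-pair : ∀ n y z (f g : Dih n → ℕ) → ΣV n (λ w → y * f w + z * g w) ≡ y * ΣV n f + z * ΣV n g
ΣV-pair n y z f g = trans (ΣV-+ n (λ w → y * f w) (λ w → z * g w)) (cong₂ _+_ (ΣV-* n y f) (ΣV-* n z g))

-- The linear-algebra step of the path count in the layered digraph.
ΣV-expand : ∀ n x y z (f g h k : Dih n → ℕ) →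
  ΣV n (λ w → x * (y * f w + z * g w) + (y * h w + z * k w)) ≡ x * (y * ΣV n f + z * ΣV n g) + (y * ΣV n h + z * ΣV n k)
ΣV-expand n x y z f g h k = begin
  ΣV n (λ w → x * (y * f w + z * g w) + (y * h w + z * k w))
    ≡⟨ ΣV-+ n (λ w → x * (y * f w + z * g w)) (λ w → y * h w + z * k w) ⟩
  ΣV n (λ w → x * (y * f w + z * g w)) + ΣV n (λ w → y * h w + z * k w)
    ≡⟨ cong₂ _+_ (trans (ΣV-* n x (λ w → y * f w + z * g w)) (cong (x *_) (ΣV-pair n y z f g))) (ΣV-pair n y z h k) ⟩
  x * (y * ΣV n f + z * ΣV n g) + (y * ΣV n h + z * ΣV n k) ∎

ΣV-cell : ∀ n (h : Fin 2 → ℕ) → ΣV n (λ w → h (proj₁ w)) ≡ n * ∑[ c < 2 ] h c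
ΣV-cell n h = trans (sum-cong-≗ (λ c → sum-const n (h c))) (sym (*-distribˡ-sum n h))

ΣV-weighted : ∀ n (h : Fin 2 → ℕ) (g : Dih n → ℕ) →
  ΣV n (λ w → h (proj₁ w) * g w) ≡ ∑[ c < 2 ] (h c * ∑[ b < n ] g (c , b))
ΣV-weighted n h g = sum-cong-≗ (λ c → sym (*-distribˡ-sum (h c) (λ b → g (c , b))))

ΣV-comm : ∀ n L (f : Dih n → Fin L → ℕ) → ΣV n (λ w → ∑[ q < L ] f w q) ≡ ∑[ q < L ] ΣV n (λ w → f w q)
ΣV-comm n L f = trans (sum-cong-≗ (λ a → ∑-comm (λ b q → f (a , b) q))) (∑-comm (λ a q → ∑[ b < n ] f (a , b) q))

record SquareRegular {V : Set} (vs : List V) (A : V → V → Bool) (k μ : ℕ) : Set where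
  field
    loopless : ∀ x → A x x ≡ false
    outDeg   : ∀ x → countL vs (λ y → A x y) ≡ k
    inDeg    : ∀ y → countL vs (λ x → A x y) ≡ k
    square   : ∀ x y → countL vs (λ z → A x z ∧ A z y) + ind (A x y) ≡ μ

-- A² + A = μJ gives t = μ on the diagonal, λ = μ - 1 on arcs and μ on non-arcs.
squareRegular⇒DSRG : {V : Set} {vs : List V} {A : V → V → Bool} {N k μ lam : ℕ} →
  length vs ≡ N → lam + 1 ≡ μ → SquareRegular vs A k μ → IsDSRG vs A N k μ lam μ
squareRegular⇒DSRG {vs = vs} {A} {lam = lam} order lam+1 sr = record
  { order = order
  ; loopless = loopless
  ; outReg = outDeg
  ; inReg = inDeg
  ; sqDiag = λ x → trans (sym (+-identityʳ _)) (subst (λ b → paths x x + ind b ≡ _) (loopless x) (square x x))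
  ; sqAdj = λ x y _ arc → +-cancelʳ-≡ _ _ _ (trans (subst (λ b → paths x y + ind b ≡ _) arc (square x y)) (sym lam+1))
  ; sqNonAdj = λ x y _ noArc → trans (sym (+-identityʳ _)) (subst (λ b → paths x y + ind b ≡ _) noArc (square x y))
  }
  where
  open SquareRegular sr
  paths : _ → _ → ℕ
  paths x y = countL vs (λ z → A x z ∧ A z y)

squareRegular-positions : {V : Set} (vs : List V) {A : V → V → Bool} {k μ : ℕ} → SquareRegular vs A k μ →
  SquareRegular (allFin (length vs)) (λ x y → A (lookup vs x) (lookup vs y)) k μ
squareRegular-positions vs {A} sr = record
  { loopless = λ x → loopless (lookup vs x)
  ; outDeg = λ x → trans (countL-lookup vs (A (lookup vs x))) (outDeg (lookup vs x))
  ; inDeg = λ y → trans (countL-lookup vs (λ x → A x (lookup vs y))) (inDeg (lookup vs y))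
  ; square = λ x y → trans (cong (_+ ind (A (lookup vs x) (lookup vs y)))
                              (countL-lookup vs (λ z → A (lookup vs x) z ∧ A z (lookup vs y))))
                       (square (lookup vs x) (lookup vs y))
  }
  where open SquareRegular sr

-- Arithmetic in ℤ_k on Fin k.  diff b d is the residue of d - b, written
-- exactly as it arises from the multiplication of D_k.
module Cyclic (k : ℕ) .{{_ : NonZero k}} where

  neg : Fin k → Fin k
  neg = negMod k

  rot : ℕ → Fin k → Fin k
  rot c x = (toℕ x + c) mod k

  diff : Fin k → Fin k → ℕ
  diff b d = toℕ (rot (toℕ (neg b)) d)

  toℕ-mod : ∀ a → toℕ (a mod k) ≡ a % k
  toℕ-mod a = toℕ-fromℕ< (m%n<n a k)

  mod-absorbʳ : ∀ a b → (a + b % k) % k ≡ (a + b) % k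
  mod-absorbʳ a b = begin
    (a + b % k) % k          ≡⟨ %-distribˡ-+ a (b % k) k ⟩
    (a % k + b % k % k) % k  ≡⟨ cong (λ z → (a % k + z) % k) (m%n%n≡m%n b k) ⟩
    (a % k + b % k) % k      ≡⟨ %-distribˡ-+ a b k ⟨
    (a + b) % k              ∎

  mod-absorbˡ : ∀ a b → (a % k + b) % k ≡ (a + b) % k
  mod-absorbˡ a b = trans (cong (_% k) (+-comm (a % k) b)) (trans (mod-absorbʳ b a) (cong (_% k) (+-comm b a)))

  rot-cancel : ∀ c c′ → c + c′ ≡ k → ∀ x → rot c′ (rot c x) ≡ x
  rot-cancel c c′ c+c′ x = toℕ-injective (begin
    toℕ (rot c′ (rot c x))       ≡⟨ toℕ-mod _ ⟩
    (toℕ (rot c x) + c′) % k     ≡⟨ cong (λ z → (z + c′) % k) (toℕ-mod _) ⟩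
    ((toℕ x + c) % k + c′) % k   ≡⟨ mod-absorbˡ (toℕ x + c) c′ ⟩
    (toℕ x + c + c′) % k         ≡⟨ cong (_% k) (trans (+-assoc (toℕ x) c c′) (cong (toℕ x +_) c+c′)) ⟩
    (toℕ x + k) % k              ≡⟨ [m+n]%n≡m%n (toℕ x) k ⟩
    toℕ x % k                    ≡⟨ m<n⇒m%n≡m (toℕ<n x) ⟩
    toℕ x                        ∎)

  sum-rot : ∀ c → c ≤ k → (f : Fin k → ℕ) → ∑[ i < k ] f (rot c i) ≡ ∑[ i < k ] f i
  sum-rot c c≤k = sum-bijection (rot c) (rot (k ∸ c))
    (rot-cancel (k ∸ c) c (m∸n+n≡m c≤k)) (rot-cancel c (k ∸ c) (m+[n∸m]≡n c≤k))

  toℕ-neg : ∀ b → toℕ (neg b) ≡ (k ∸ toℕ b) % k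
  toℕ-neg b = toℕ-mod (k ∸ toℕ b)

  neg-involutive : ∀ x → neg (neg x) ≡ x
  neg-involutive x = toℕ-injective (trans (toℕ-neg (neg x))
    (trans (cong (λ z → (k ∸ z) % k) (toℕ-neg x)) (twice-negated (toℕ x) (toℕ<n x))))
    where
    twice-negated : ∀ a → a < k → (k ∸ (k ∸ a) % k) % k ≡ a
    twice-negated zero _ = trans (cong (λ z → (k ∸ z) % k) (n%n≡0 k)) (n%n≡0 k)
    twice-negated (suc a) a<k = begin
      (k ∸ (k ∸ suc a) % k) % k ≡⟨ cong (λ z → (k ∸ z) % k) (m<n⇒m%n≡m (∸-monoʳ-< {k} {suc a} {0} (s≤s z≤n) (<⇒≤ a<k))) ⟩
      (k ∸ (k ∸ suc a)) % k     ≡⟨ cong (_% k) (m∸[m∸n]≡n (<⇒≤ a<k)) ⟩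
      suc a % k                 ≡⟨ m<n⇒m%n≡m a<k ⟩
      suc a                     ∎

  sum-diffˡ : ∀ b (f : ℕ → ℕ) → ∑[ d < k ] f (diff b d) ≡ ∑[ d < k ] f (toℕ d)
  sum-diffˡ b f = sum-rot (toℕ (neg b)) (<⇒≤ (toℕ<n (neg b))) (f ∘ toℕ)

  sum-diffʳ : ∀ b (f : ℕ → ℕ) → ∑[ d < k ] f (diff d b) ≡ ∑[ d < k ] f (toℕ d)
  sum-diffʳ b f = begin
    ∑[ d < k ] f (diff d b)                ≡⟨ sum-cong-≗ (λ d → cong (λ z → f (toℕ (z mod k))) (+-comm (toℕ b) (toℕ (neg d)))) ⟩
    ∑[ d < k ] f (toℕ (rot (toℕ b) (neg d))) ≡⟨ sum-bijection neg neg neg-involutive neg-involutive (f ∘ toℕ ∘ rot (toℕ b)) ⟩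
    ∑[ d < k ] f (toℕ (rot (toℕ b) d))     ≡⟨ sum-rot (toℕ b) (<⇒≤ (toℕ<n b)) (f ∘ toℕ) ⟩
    ∑[ d < k ] f (toℕ d)                   ∎

  diff-value : ∀ b d → diff b d ≡ (toℕ d + (k ∸ toℕ b)) % k
  diff-value b d = trans (toℕ-mod _) (trans (cong (λ z → (toℕ d + z) % k) (toℕ-neg b)) (mod-absorbʳ (toℕ d) (k ∸ toℕ b)))

  diff-≤ : ∀ b d → toℕ b ≤ toℕ d → diff b d ≡ toℕ d ∸ toℕ b
  diff-≤ b d b≤d = begin
    diff b d                          ≡⟨ diff-value b d ⟩
    (toℕ d + (k ∸ toℕ b)) % k         ≡⟨ cong (λ z → (z + (k ∸ toℕ b)) % k) (m∸n+n≡m b≤d) ⟨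
    (toℕ d ∸ toℕ b + toℕ b + (k ∸ toℕ b)) % k ≡⟨ cong (_% k) (+-assoc (toℕ d ∸ toℕ b) (toℕ b) _) ⟩
    (toℕ d ∸ toℕ b + (toℕ b + (k ∸ toℕ b))) % k ≡⟨ cong (λ z → (toℕ d ∸ toℕ b + z) % k) (m+[n∸m]≡n (<⇒≤ (toℕ<n b))) ⟩
    (toℕ d ∸ toℕ b + k) % k           ≡⟨ [m+n]%n≡m%n (toℕ d ∸ toℕ b) k ⟩
    (toℕ d ∸ toℕ b) % k               ≡⟨ m<n⇒m%n≡m (≤-<-trans (m∸n≤m (toℕ d) (toℕ b)) (toℕ<n d)) ⟩
    toℕ d ∸ toℕ b                     ∎

  diff-> : ∀ b d → toℕ d < toℕ b → diff b d ≡ toℕ d + (k ∸ toℕ b)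
  diff-> b d d<b = trans (diff-value b d) (m<n⇒m%n≡m (subst (toℕ d + (k ∸ toℕ b) <_)
    (m+[n∸m]≡n (<⇒≤ (toℕ<n b))) (+-monoˡ-< (k ∸ toℕ b) d<b)))

  diff-self : ∀ b → diff b b ≡ 0
  diff-self b = trans (diff-≤ b b ≤-refl) (n∸n≡0 (toℕ b))

  diff-pair-< : ∀ b d → toℕ b < toℕ d → diff b d + diff d b ≡ k
  diff-pair-< b d b<d = begin
    diff b d + diff d b                        ≡⟨ cong₂ _+_ (diff-≤ b d (<⇒≤ b<d)) (diff-> d b b<d) ⟩
    (toℕ d ∸ toℕ b) + (toℕ b + (k ∸ toℕ d))    ≡⟨ +-assoc (toℕ d ∸ toℕ b) (toℕ b) _ ⟨
    (toℕ d ∸ toℕ b) + toℕ b + (k ∸ toℕ d)      ≡⟨ cong (_+ (k ∸ toℕ d)) (m∸n+n≡m (<⇒≤ b<d)) ⟩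
    toℕ d + (k ∸ toℕ d)                        ≡⟨ m+[n∸m]≡n (<⇒≤ (toℕ<n d)) ⟩
    k                                          ∎

  diff-pair : ∀ b d → b ≢ d → diff b d + diff d b ≡ k
  diff-pair b d b≢d with <-cmp (toℕ b) (toℕ d)
  ... | tri< b<d _ _ = diff-pair-< b d b<d
  ... | tri≈ _ b=d _ = ⊥-elim (b≢d (toℕ-injective b=d))
  ... | tri> _ _ d<b = trans (+-comm (diff b d) (diff d b)) (diff-pair-< d b d<b)

  -- d - b is a nonzero residue when b ≠ d (otherwise b - d would be k)
  diff-pos : ∀ b d → b ≢ d → 0 < diff b d
  diff-pos b d b≢d = n≢0⇒n>0 (λ diff≡0 → <-irrefl (sym (trans (sym (diff-pair b d b≢d)) (cong (_+ diff d b) diff≡0)))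
    (toℕ<n (rot (toℕ (neg d)) b)))

inHalf : ℕ → ℕ → Bool
inHalf M e = (1 ≤ᵇ e) ∧ (e ≤ᵇ M)

count-below : ∀ N a → a ≤ N → ∑[ i < N ] ind (suc (toℕ i) ≤ᵇ a) ≡ a
count-below zero zero _ = refl
count-below (suc N) zero _ = sum-zero (suc N)
count-below (suc N) (suc a) (s≤s a≤N) = cong suc (count-below N a a≤N)

count-inHalf : ∀ N M → N ≡ suc (M + M) → ∑[ e < N ] ind (inHalf M (toℕ e)) ≡ M
count-inHalf _ M refl = count-below (M + M) M (m≤m+n M M)

inHalf-pair : ∀ M x y → x + y ≡ suc (M + M) → 0 < x → 0 < y → ind (inHalf M x) + ind (inHalf M y) ≡ 1
inHalf-pair M (suc x) (suc y) x+y _ _ with suc x ≤ᵇ M | ≤ᵇ-reflects-≤ (suc x) M | suc y ≤ᵇ M | ≤ᵇ-reflects-≤ (suc y) M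
... | true  | ofʸ x≤M | true  | ofʸ y≤M = ⊥-elim (1+n≰n (subst (_≤ M + M) x+y (+-mono-≤ x≤M y≤M)))
... | true  | _       | false | _       = refl
... | false | _       | true  | _       = refl
... | false | ofⁿ x≰M | false | ofⁿ y≰M = ⊥-elim (1+n≰n (subst (suc (suc (M + M)) ≤_) x+y
      (subst (_≤ suc x + suc y) (+-suc (suc M) M) (+-mono-≤ (≰⇒> x≰M) (≰⇒> y≰M)))))

module CayleyDihedral (n : ℕ) .{{_ : NonZero n}} (n-odd : n ≡ suc ((n ∸ 1) / 2 + (n ∸ 1) / 2)) where
  open Cyclic n

  M : ℕ
  M = (n ∸ 1) / 2

  Γ : Dih n → Dih n → Bool
  Γ = GammaDih n

  row : Fin 2 → Fin n → Fin n → Bool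
  row fz b d = inHalf M (diff b d)
  row (fs fz) b d = inHalf M (diff d b)

  Γ-row : ∀ a b c d → Γ (a , b) (c , d) ≡ row a b d
  Γ-row fz b c d = refl
  Γ-row (fs fz) b c d = cong (λ z → inHalf M (toℕ (z mod n))) (+-comm (toℕ (negMod n d)) (toℕ b))

  row-count : ∀ a b → ∑[ d < n ] ind (row a b d) ≡ M
  row-count fz b = trans (sum-diffˡ b (ind ∘ inHalf M)) (count-inHalf n M n-odd)
  row-count (fs fz) b = trans (sum-diffʳ b (ind ∘ inHalf M)) (count-inHalf n M n-odd)

  -- 0 ∉ X
  Γ-loopless : ∀ u → Γ u u ≡ false
  Γ-loopless (a , b) = trans (Γ-row a b a b) (row-self a)
    where
    row-self : ∀ a → row a b b ≡ false
    row-self fz = cong (inHalf M) (diff-self b)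
    row-self (fs fz) = cong (inHalf M) (diff-self b)

  Γ-out : ∀ u → ΣV n (λ w → ind (Γ u w)) ≡ 2 * M
  Γ-out (a , b) = trans (sum-cong-≗ (λ c → trans (sum-cong-≗ (λ d → cong ind (Γ-row a b c d))) (row-count a b)))
    (sum-const 2 M)

  Γ-in : ∀ v c → ∑[ b < n ] ind (Γ (c , b) v) ≡ M
  Γ-in (a , d) fz = trans (sum-diffʳ d (ind ∘ inHalf M)) (count-inHalf n M n-odd)
  Γ-in (a , d) (fs fz) = trans (sum-cong-≗ (λ b → cong ind (Γ-row (fs fz) b a d)))
    (trans (sum-diffˡ d (ind ∘ inHalf M)) (count-inHalf n M n-odd))

  -- {1..M} and its negative partition ℤ_n ∖ {0}: for f ≠ d exactly one of
  -- d - f, f - d lies in {1..M}.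
  Γ-link : ∀ d f → δ d f + (ind (inHalf M (diff f d)) + ind (inHalf M (diff d f))) ≡ 1
  Γ-link d f with toℕ d ≡ᵇ toℕ f in e
  ... | true = subst (λ z → 1 + (ind (inHalf M (diff f z)) + ind (inHalf M (diff z f))) ≡ 1)
                 (sym (≡ᵇ-true {r = d} {s = f} e)) (cong (λ z → 1 + (ind (inHalf M z) + ind (inHalf M z))) (diff-self f))
  ... | false = inHalf-pair M (diff f d) (diff d f) (trans (diff-pair f d f≢d) n-odd)
                  (diff-pos f d f≢d) (diff-pos d f (≡ᵇ-false e))
    where
    f≢d : f ≢ d
    f≢d f≡d = ≡ᵇ-false e (sym f≡d)

  Γ-square : ∀ u v → ΣV n (λ w → ind (Γ u w ∧ Γ w v)) + ind (Γ u v) ≡ M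
  Γ-square (a , b) (c , d) = begin
    ΣV n (λ w → ind (Γ (a , b) w ∧ Γ w (c , d))) + ind (Γ (a , b) (c , d))
      ≡⟨ cong₂ _+_ (sum-cong-≗ (λ c′ → sum-cong-≗ (two-steps c′))) (cong ind (Γ-row a b c d)) ⟩
    (∑[ c′ < 2 ] ∑[ f < n ] (ind (row a b f) * ind (row c′ f d))) + ind (row a b d)
      ≡⟨ cong (_+ ind (row a b d)) (∑-comm (λ c′ f → ind (row a b f) * ind (row c′ f d))) ⟩
    (∑[ f < n ] ∑[ c′ < 2 ] (ind (row a b f) * ind (row c′ f d))) + ind (row a b d)
      ≡⟨ cong (_+ ind (row a b d)) (sum-cong-≗ (λ f → both-cells (ind (row a b f)) _ _)) ⟩
    (∑[ f < n ] (pair f * ind (row a b f))) + ind (row a b d)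
      ≡⟨ sum-complement d pair (λ f → ind (row a b f)) (Γ-link d) ⟩
    ∑[ f < n ] ind (row a b f)
      ≡⟨ row-count a b ⟩
    M ∎
    where
    two-steps : ∀ c′ f → ind (Γ (a , b) (c′ , f) ∧ Γ (c′ , f) (c , d)) ≡ ind (row a b f) * ind (row c′ f d)
    two-steps c′ f = trans (ind-∧ (Γ (a , b) (c′ , f)) (Γ (c′ , f) (c , d)))
      (cong₂ (λ x y → ind x * ind y) (Γ-row a b c′ f) (Γ-row c′ f c d))
    -- summing over the cell of the middle vertex f
    pair : Fin n → ℕ
    pair f = ind (inHalf M (diff f d)) + ind (inHalf M (diff d f))
    both-cells : ∀ g x y → g * x + (g * y + 0) ≡ (x + y) * g
    both-cells = solve 3 (λ g x y → g :* x :+ (g :* y :+ con 0) := (x :+ y) :* g) refl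

module Layered (n m : ℕ) (n≡2m+1 : n ≡ suc (m + m)) (A : Dih n → Dih n → Bool)
  (A-loopless : ∀ u → A u u ≡ false)
  (A-out : ∀ u → ΣV n (λ w → ind (A u w)) ≡ 2 * m)
  (A-in : ∀ v c → ∑[ b < n ] ind (A (c , b) v) ≡ m)
  (A-square : ∀ u v → ΣV n (λ w → ind (A u w ∧ A w v)) + ind (A u v) ≡ m)
  (L j : ℕ) (ρ : Fin L → Fin L → Fin 2 → Bool)
  (ρ-irrefl : ∀ r c → ρ r r c ≡ false)
  (ρ-unique : ∀ r s → r ≢ s → ∑[ c < 2 ] ind (ρ r s c) ≡ 1)
  (ρ-in : ∀ s c → ∑[ r < L ] ind (ρ r s c) ≡ j)
  (ρ-out : ∀ r c → ∑[ s < L ] ind (ρ r s c) ≡ j)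
  where

  W : Set
  W = Dih n × Fin L

  -- the vertex enumeration and the adjacency; for L = 3 and ρ = joinCross
  -- these are literally those of the π-join Γ^1_π
  vertices : List W
  vertices = prodList (dihElems n) (allFin L)

  JA : W → W → Bool
  JA (u , r) (v , s) = ((toℕ r ≡ᵇ toℕ s) ∧ A u v) ∨ ρ r s (proj₁ v)

  ΣW : (W → ℕ) → ℕ
  ΣW f = ∑[ q < L ] ΣV n (λ w → f (w , q))

  countL-vertices : ∀ p → countL vertices p ≡ ΣW (ind ∘ p)
  countL-vertices p = begin
    countL vertices p                                          ≡⟨ countL-sumL vertices p ⟩
    sumL vertices (ind ∘ p)                                    ≡⟨ sumL-prod (dihElems n) (allFin L) (ind ∘ p) ⟩
    sumL (dihElems n) (λ w → sumL (allFin L) (λ q → ind (p (w , q)))) ≡⟨ sumL-dih n _ ⟩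
    ΣV n (λ w → sumL (allFin L) (λ q → ind (p (w , q))))      ≡⟨ sum-cong-≗ (λ a → sum-cong-≗ (λ b → sumL-allFin L (λ q → ind (p ((a , b) , q))))) ⟩
    ΣV n (λ w → ∑[ q < L ] ind (p (w , q)))                   ≡⟨ ΣV-comm n L (λ w q → ind (p (w , q))) ⟩
    ΣW (ind ∘ p)                                               ∎

  links : Fin L → Fin L → ℕ
  links r s = ∑[ c < 2 ] ind (ρ r s c)

  layer-link : ∀ r s → δ r s + links r s ≡ 1
  layer-link r s with toℕ r ≡ᵇ toℕ s in e
  ... | true = cong suc (subst (λ z → links r z ≡ 0) (≡ᵇ-true e)
                 (cong₂ (λ x y → ind x + (ind y + 0)) (ρ-irrefl r fz) (ρ-irrefl r (fs fz))))
  ... | false = ρ-unique r s (≡ᵇ-false e)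

  ind-JA : ∀ u r v s → ind (JA (u , r) (v , s)) ≡ δ r s * ind (A u v) + ind (ρ r s (proj₁ v))
  ind-JA u r v s with toℕ r ≡ᵇ toℕ s in e
  ... | true = begin
    ind (A u v ∨ ρ r s (proj₁ v))  ≡⟨ cong (λ z → ind (A u v ∨ z)) no-cross ⟩
    ind (A u v ∨ false)            ≡⟨ cong ind (∨-identityʳ (A u v)) ⟩
    ind (A u v)                    ≡⟨ trans (+-identityʳ _) (*-identityˡ _) ⟨
    1 * ind (A u v) + 0            ≡⟨ cong (λ z → 1 * ind (A u v) + ind z) no-cross ⟨
    1 * ind (A u v) + ind (ρ r s (proj₁ v)) ∎
    where
    no-cross : ρ r s (proj₁ v) ≡ false
    no-cross = subst (λ z → ρ r z (proj₁ v) ≡ false) (≡ᵇ-true e) (ρ-irrefl r (proj₁ v))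
  ... | false = refl

  JA-loopless : ∀ x → JA x x ≡ false
  JA-loopless (u , r) = ind≡0 (trans (ind-JA u r u r)
    (trans (cong₂ (λ x y → δ r r * ind x + ind y) (A-loopless u) (ρ-irrefl r (proj₁ u)))
      (trans (+-identityʳ _) (*-zeroʳ (δ r r)))))

  layer-out : ∀ u r q → ΣV n (λ w → ind (JA (u , r) (w , q))) ≡ δ r q * (2 * m) + n * links r q
  layer-out u r q = begin
    ΣV n (λ w → ind (JA (u , r) (w , q)))
      ≡⟨ sum-cong-≗ (λ a → sum-cong-≗ (λ b → ind-JA u r (a , b) q)) ⟩
    ΣV n (λ w → δ r q * ind (A u w) + ind (ρ r q (proj₁ w)))
      ≡⟨ ΣV-+ n (λ w → δ r q * ind (A u w)) (λ w → ind (ρ r q (proj₁ w))) ⟩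
    ΣV n (λ w → δ r q * ind (A u w)) + ΣV n (λ w → ind (ρ r q (proj₁ w)))
      ≡⟨ cong₂ _+_ (trans (ΣV-* n (δ r q) (λ w → ind (A u w))) (cong (δ r q *_) (A-out u))) (ΣV-cell n (λ c → ind (ρ r q c))) ⟩
    δ r q * (2 * m) + n * links r q ∎

  layer-in : ∀ v s q → ΣV n (λ w → ind (JA (w , q) (v , s))) ≡ δ q s * (2 * m) + n * (2 * ind (ρ q s (proj₁ v)))
  layer-in v s q = begin
    ΣV n (λ w → ind (JA (w , q) (v , s)))
      ≡⟨ sum-cong-≗ (λ a → sum-cong-≗ (λ b → ind-JA (a , b) q v s)) ⟩
    ΣV n (λ w → δ q s * ind (A w v) + ind (ρ q s (proj₁ v)))
      ≡⟨ ΣV-+ n (λ w → δ q s * ind (A w v)) (λ _ → ind (ρ q s (proj₁ v))) ⟩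
    ΣV n (λ w → δ q s * ind (A w v)) + ΣV n (λ _ → ind (ρ q s (proj₁ v)))
      ≡⟨ cong₂ _+_ (trans (ΣV-* n (δ q s) (λ w → ind (A w v))) (cong (δ q s *_) in-A))
                   (trans (ΣV-cell n (λ _ → ind (ρ q s (proj₁ v)))) (cong (n *_) (sum-const 2 (ind (ρ q s (proj₁ v)))))) ⟩
    δ q s * (2 * m) + n * (2 * ind (ρ q s (proj₁ v))) ∎
    where
    in-A : ΣV n (λ w → ind (A w v)) ≡ 2 * m
    in-A = trans (sum-cong-≗ (A-in v)) (sum-const 2 m)

  out-degree : ∀ x → ΣW (λ z → ind (JA x z)) ≡ 2 * m + n * (2 * j)
  out-degree (u , r) = begin
    ΣW (λ z → ind (JA (u , r) z))
      ≡⟨ sum-cong-≗ (layer-out u r) ⟩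
    ∑[ q < L ] (δ r q * (2 * m) + n * links r q)
      ≡⟨ ∑-distrib-+ (λ q → δ r q * (2 * m)) (λ q → n * links r q) ⟩
    (∑[ q < L ] (δ r q * (2 * m))) + (∑[ q < L ] (n * links r q))
      ≡⟨ cong₂ _+_ (sum-delta r (λ _ → 2 * m)) (sym (*-distribˡ-sum n (links r))) ⟩
    2 * m + n * (∑[ q < L ] links r q)
      ≡⟨ cong (λ z → 2 * m + n * z) links-total ⟩
    2 * m + n * (2 * j) ∎
    where
    links-total : ∑[ q < L ] links r q ≡ 2 * j
    links-total = trans (∑-comm (λ q c → ind (ρ r q c))) (trans (sum-cong-≗ (ρ-out r)) (sum-const 2 j))

  in-degree : ∀ y → ΣW (λ z → ind (JA z y)) ≡ 2 * m + n * (2 * j)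
  in-degree (v , s) = begin
    ΣW (λ z → ind (JA z (v , s)))
      ≡⟨ sum-cong-≗ (layer-in v s) ⟩
    ∑[ q < L ] (δ q s * (2 * m) + n * (2 * cross q))
      ≡⟨ ∑-distrib-+ (λ q → δ q s * (2 * m)) (λ q → n * (2 * cross q)) ⟩
    (∑[ q < L ] (δ q s * (2 * m))) + (∑[ q < L ] (n * (2 * cross q)))
      ≡⟨ cong₂ _+_ (sum-delta′ s (λ _ → 2 * m)) (sym (trans (cong (n *_) (*-distribˡ-sum 2 cross)) (*-distribˡ-sum n (λ q → 2 * cross q)))) ⟩
    2 * m + n * (2 * ∑[ q < L ] cross q)
      ≡⟨ cong (λ z → 2 * m + n * (2 * z)) (ρ-in s (proj₁ v)) ⟩
    2 * m + n * (2 * j) ∎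
    where
    cross : Fin L → ℕ
    cross q = ind (ρ q s (proj₁ v))

  P : Dih n → Dih n → ℕ
  P u v = ΣV n (λ w → ind (A u w ∧ A w v))

  cross : Fin L → Fin L → Dih n → ℕ
  cross q s v = ind (ρ q s (proj₁ v))

  cross-then-A : ∀ r q v → ΣV n (λ w → cross r q w * ind (A w v)) ≡ m * links r q
  cross-then-A r q v = begin
    ΣV n (λ w → cross r q w * ind (A w v))
      ≡⟨ ΣV-weighted n (λ c → ind (ρ r q c)) (λ w → ind (A w v)) ⟩
    ∑[ c < 2 ] (ind (ρ r q c) * ∑[ b < n ] ind (A (c , b) v))
      ≡⟨ sum-cong-≗ (λ c → trans (cong (ind (ρ r q c) *_) (A-in v c)) (*-comm (ind (ρ r q c)) m)) ⟩
    ∑[ c < 2 ] (m * ind (ρ r q c))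
      ≡⟨ *-distribˡ-sum m (λ c → ind (ρ r q c)) ⟨
    m * links r q ∎

  layer-paths : ∀ u r v s q → ΣV n (λ w → ind (JA (u , r) (w , q) ∧ JA (w , q) (v , s))) ≡
    δ r q * (δ q s * P u v + cross q s v * (2 * m)) + (δ q s * (m * links r q) + n * (links r q * cross q s v))
  layer-paths u r v s q = begin
    ΣV n (λ w → ind (JA (u , r) (w , q) ∧ JA (w , q) (v , s)))
      ≡⟨ sum-cong-≗ (λ a → sum-cong-≗ (λ b → expand (a , b))) ⟩
    ΣV n (λ w → δ r q * (δ q s * ind (A u w ∧ A w v) + cross q s v * ind (A u w))
               + (δ q s * (cross r q w * ind (A w v)) + cross q s v * cross r q w))
      ≡⟨ ΣV-expand n (δ r q) (δ q s) (cross q s v) (λ w → ind (A u w ∧ A w v)) (λ w → ind (A u w))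
           (λ w → cross r q w * ind (A w v)) (cross r q) ⟩
    δ r q * (δ q s * P u v + cross q s v * ΣV n (λ w → ind (A u w)))
      + (δ q s * ΣV n (λ w → cross r q w * ind (A w v)) + cross q s v * ΣV n (cross r q))
      ≡⟨ cong₂ (λ x y → δ r q * (δ q s * P u v + cross q s v * x) + y) (A-out u)
           (cong₂ (λ x y → δ q s * x + cross q s v * y) (cross-then-A r q v) (ΣV-cell n (λ c → ind (ρ r q c)))) ⟩
    δ r q * (δ q s * P u v + cross q s v * (2 * m)) + (δ q s * (m * links r q) + cross q s v * (n * links r q))
      ≡⟨ cong (λ x → δ r q * (δ q s * P u v + cross q s v * (2 * m)) + (δ q s * (m * links r q) + x))
           (solve 3 (λ x n l → x :* (n :* l) := n :* (l :* x)) refl (cross q s v) n (links r q)) ⟩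
    δ r q * (δ q s * P u v + cross q s v * (2 * m)) + (δ q s * (m * links r q) + n * (links r q * cross q s v)) ∎
    where
    product : ∀ x a p y b z → (x * a + p) * (y * b + z) ≡ x * (y * (a * b) + z * a) + (y * (p * b) + z * p)
    product = solve 6 (λ x a p y b z → (x :* a :+ p) :* (y :* b :+ z) := x :* (y :* (a :* b) :+ z :* a) :+ (y :* (p :* b) :+ z :* p)) refl
    expand : ∀ w → ind (JA (u , r) (w , q) ∧ JA (w , q) (v , s)) ≡
      δ r q * (δ q s * ind (A u w ∧ A w v) + cross q s v * ind (A u w)) + (δ q s * (cross r q w * ind (A w v)) + cross q s v * cross r q w)
    expand w = begin
      ind (JA (u , r) (w , q) ∧ JA (w , q) (v , s))
        ≡⟨ ind-∧ (JA (u , r) (w , q)) (JA (w , q) (v , s)) ⟩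
      ind (JA (u , r) (w , q)) * ind (JA (w , q) (v , s))
        ≡⟨ cong₂ _*_ (ind-JA u r w q) (ind-JA w q v s) ⟩
      (δ r q * ind (A u w) + cross r q w) * (δ q s * ind (A w v) + cross q s v)
        ≡⟨ product (δ r q) (ind (A u w)) (cross r q w) (δ q s) (ind (A w v)) (cross q s v) ⟩
      δ r q * (δ q s * (ind (A u w) * ind (A w v)) + cross q s v * ind (A u w)) + (δ q s * (cross r q w * ind (A w v)) + cross q s v * cross r q w)
        ≡⟨ cong (λ x → δ r q * (δ q s * x + cross q s v * ind (A u w)) + (δ q s * (cross r q w * ind (A w v)) + cross q s v * cross r q w)) (ind-∧ (A u w) (A w v)) ⟨
      δ r q * (δ q s * ind (A u w ∧ A w v) + cross q s v * ind (A u w)) + (δ q s * (cross r q w * ind (A w v)) + cross q s v * cross r q w) ∎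

  paths : W → W → ℕ
  paths x y = ΣW (λ z → ind (JA x z ∧ JA z y))

  cross-into : ∀ r s v → (∑[ q < L ] (links r q * cross q s v)) + cross r s v ≡ j
  cross-into r s v = trans (sum-complement r (links r) (λ q → cross q s v) (layer-link r)) (ρ-in s (proj₁ v))

  paths-identity : ∀ x y → paths x y + ind (JA x y) ≡ m + n * j
  paths-identity (u , r) (v , s) = begin
    paths (u , r) (v , s) + ind (JA (u , r) (v , s))
      ≡⟨ cong₂ _+_ paths-sum (ind-JA u r v s) ⟩
    (δ r s * P u v + cross r s v * (2 * m)) + (m * links r s + n * Y) + (δ r s * ind (A u v) + cross r s v)
      ≡⟨ regroup (δ r s) (P u v) (ind (A u v)) (cross r s v) (links r s) Y ⟩
    δ r s * (P u v + ind (A u v)) + m * links r s + n * (Y + cross r s v)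
      ≡⟨ cong₂ (λ x y → δ r s * x + m * links r s + n * y) (A-square u v) (cross-into r s v) ⟩
    δ r s * m + m * links r s + n * j
      ≡⟨ cong (_+ n * j) layer-or-cell ⟩
    m + n * j ∎
    where
    Y : ℕ
    Y = ∑[ q < L ] (links r q * cross q s v)
    firstStepInLayer : Fin L → ℕ
    firstStepInLayer q = δ q s * P u v + cross q s v * (2 * m)
    paths-sum : paths (u , r) (v , s) ≡ firstStepInLayer r + (m * links r s + n * Y)
    paths-sum = begin
      paths (u , r) (v , s)
        ≡⟨ sum-cong-≗ (layer-paths u r v s) ⟩
      ∑[ q < L ] (δ r q * firstStepInLayer q + (δ q s * (m * links r q) + n * (links r q * cross q s v)))
        ≡⟨ ∑-distrib-+ (λ q → δ r q * firstStepInLayer q) (λ q → δ q s * (m * links r q) + n * (links r q * cross q s v)) ⟩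
      (∑[ q < L ] (δ r q * firstStepInLayer q)) + (∑[ q < L ] (δ q s * (m * links r q) + n * (links r q * cross q s v)))
        ≡⟨ cong₂ _+_ (sum-delta r firstStepInLayer) (∑-distrib-+ (λ q → δ q s * (m * links r q)) (λ q → n * (links r q * cross q s v))) ⟩
      firstStepInLayer r + ((∑[ q < L ] (δ q s * (m * links r q))) + (∑[ q < L ] (n * (links r q * cross q s v))))
        ≡⟨ cong (firstStepInLayer r +_) (cong₂ _+_ (sum-delta′ s (λ q → m * links r q)) (sym (*-distribˡ-sum n (λ q → links r q * cross q s v)))) ⟩
      firstStepInLayer r + (m * links r s + n * Y) ∎
    regroup : ∀ x p a c l y → (x * p + c * (2 * m)) + (m * l + n * y) + (x * a + c) ≡ x * (p + a) + m * l + n * (y + c)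
    regroup x p a c l y rewrite n≡2m+1 = solve 7 (λ m x p a c l y →
      (x :* p :+ c :* (con 2 :* m)) :+ (m :* l :+ (con 1 :+ (m :+ m)) :* y) :+ (x :* a :+ c)
        := x :* (p :+ a) :+ m :* l :+ (con 1 :+ (m :+ m)) :* (y :+ c)) refl m x p a c l y
    layer-or-cell : δ r s * m + m * links r s ≡ m
    layer-or-cell = begin
      δ r s * m + m * links r s   ≡⟨ cong (_+ m * links r s) (*-comm (δ r s) m) ⟩
      m * δ r s + m * links r s   ≡⟨ *-distribˡ-+ m (δ r s) (links r s) ⟨
      m * (δ r s + links r s)     ≡⟨ cong (m *_) (layer-link r s) ⟩
      m * 1                       ≡⟨ *-identityʳ m ⟩
      m                           ∎

  squareRegular : SquareRegular vertices JA (2 * m + n * (2 * j)) (m + n * j)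
  squareRegular = record
    { loopless = JA-loopless
    ; outDeg = λ x → trans (countL-vertices (JA x)) (out-degree x)
    ; inDeg = λ y → trans (countL-vertices (λ x → JA x y)) (in-degree y)
    ; square = λ x y → trans (cong (_+ ind (JA x y)) (countL-vertices (λ z → JA x z ∧ JA z y))) (paths-identity x y)
    }

-- Layer relations.  With 2j + 1 layers in ℤ_(2j+1), layer r is joined to
-- layer s = r + e (e = 1, …, 2j) through the cell given by the parity of e - 1.
parity : ℕ → Fin 2 → Bool
parity zero c = false
parity (suc e) c = e % 2 ≡ᵇ toℕ c

count-residue : ∀ j (c : Fin 2) → ∑[ e < j + j ] ind (toℕ e % 2 ≡ᵇ toℕ c) ≡ j
count-residue zero c = refl
count-residue (suc j) c = begin
  ∑[ e < suc j + suc j ] ind (toℕ e % 2 ≡ᵇ toℕ c)                           ≡⟨ cong (λ k → ∑[ e < suc k ] ind (toℕ e % 2 ≡ᵇ toℕ c)) (+-suc j j) ⟩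
  ind (0 ≡ᵇ toℕ c) + (ind (1 ≡ᵇ toℕ c) + ∑[ e < j + j ] ind (toℕ e % 2 ≡ᵇ toℕ c)) ≡⟨ +-assoc (ind (0 ≡ᵇ toℕ c)) (ind (1 ≡ᵇ toℕ c)) (∑[ e < j + j ] ind (toℕ e % 2 ≡ᵇ toℕ c)) ⟨
  ind (0 ≡ᵇ toℕ c) + ind (1 ≡ᵇ toℕ c) + ∑[ e < j + j ] ind (toℕ e % 2 ≡ᵇ toℕ c)   ≡⟨ cong₂ _+_ (one-of-two c) (count-residue j c) ⟩
  suc j                                                                        ∎
  where
  one-of-two : ∀ (c : Fin 2) → ind (0 ≡ᵇ toℕ c) + ind (1 ≡ᵇ toℕ c) ≡ 1
  one-of-two fz = refl
  one-of-two (fs fz) = refl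

-- hence among the differences 1, …, 2j each cell is reached j times (the
-- shift e ↦ e + 1 is absorbed by the definition of parity)
count-parity : ∀ j (c : Fin 2) → ∑[ e < suc (j + j) ] ind (parity (toℕ e) c) ≡ j
count-parity = count-residue

one-parity : ∀ e → ∑[ c < 2 ] ind (parity (suc e) c) ≡ 1
one-parity e with e % 2 | m%n<n e 2
... | 0 | _ = refl
... | 1 | _ = refl
... | suc (suc _) | s≤s (s≤s ())

module ParityLayers (j : ℕ) where
  open Cyclic (suc (j + j))

  ρ : Fin (suc (j + j)) → Fin (suc (j + j)) → Fin 2 → Bool
  ρ r s c = parity (diff r s) c

  ρ-irrefl : ∀ r c → ρ r r c ≡ false
  ρ-irrefl r c = cong (λ e → parity e c) (diff-self r)

  ρ-unique : ∀ r s → r ≢ s → ∑[ c < 2 ] ind (ρ r s c) ≡ 1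
  ρ-unique r s r≢s with diff r s | diff-pos r s r≢s
  ... | suc e | _ = one-parity e

  ρ-in : ∀ s c → ∑[ r < suc (j + j) ] ind (ρ r s c) ≡ j
  ρ-in s c = trans (sum-diffʳ s (λ e → ind (parity e c))) (count-parity j c)

  ρ-out : ∀ r c → ∑[ s < suc (j + j) ] ind (ρ r s c) ≡ j
  ρ-out r c = trans (sum-diffˡ r (λ e → ind (parity e c))) (count-parity j c)

-- The layer relation of the π-join for π = {C₁, C₂}: (u , r) → (v , r + i)
-- for v ∈ C_i.  It is the parity relation with three layers.
joinCross : Fin 3 → Fin 3 → Fin 2 → Bool
joinCross r s c = toℕ s ≡ᵇ ((toℕ r + suc (toℕ c)) % 3)

joinCross≡parity : ∀ r s c → joinCross r s c ≡ ParityLayers.ρ 1 r s c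
joinCross≡parity fz fz fz = refl
joinCross≡parity fz fz (fs fz) = refl
joinCross≡parity fz (fs fz) fz = refl
joinCross≡parity fz (fs fz) (fs fz) = refl
joinCross≡parity fz (fs (fs fz)) fz = refl
joinCross≡parity fz (fs (fs fz)) (fs fz) = refl
joinCross≡parity (fs fz) fz fz = refl
joinCross≡parity (fs fz) fz (fs fz) = refl
joinCross≡parity (fs fz) (fs fz) fz = refl
joinCross≡parity (fs fz) (fs fz) (fs fz) = refl
joinCross≡parity (fs fz) (fs (fs fz)) fz = refl
joinCross≡parity (fs fz) (fs (fs fz)) (fs fz) = refl
joinCross≡parity (fs (fs fz)) fz fz = refl
joinCross≡parity (fs (fs fz)) fz (fs fz) = refl
joinCross≡parity (fs (fs fz)) (fs fz) fz = refl
joinCross≡parity (fs (fs fz)) (fs fz) (fs fz) = refl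
joinCross≡parity (fs (fs fz)) (fs (fs fz)) fz = refl
joinCross≡parity (fs (fs fz)) (fs (fs fz)) (fs fz) = refl

module JoinLayers where
  open ParityLayers 1 using () renaming (ρ-irrefl to parity-irrefl; ρ-unique to parity-unique; ρ-in to parity-in; ρ-out to parity-out)

  ρ-irrefl : ∀ r c → joinCross r r c ≡ false
  ρ-irrefl r c = trans (joinCross≡parity r r c) (parity-irrefl r c)

  ρ-unique : ∀ r s → r ≢ s → ∑[ c < 2 ] ind (joinCross r s c) ≡ 1
  ρ-unique r s r≢s = trans (sum-cong-≗ (λ c → cong ind (joinCross≡parity r s c))) (parity-unique r s r≢s)

  ρ-in : ∀ s c → ∑[ r < 3 ] ind (joinCross r s c) ≡ 1
  ρ-in s c = trans (sum-cong-≗ (λ r → cong ind (joinCross≡parity r s c))) (parity-in s c)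

  ρ-out : ∀ r c → ∑[ s < 3 ] ind (joinCross r s c) ≡ 1
  ρ-out r c = trans (sum-cong-≗ (λ s → cong ind (joinCross≡parity r s c))) (parity-out r c)

*2≡+ : ∀ a → a * 2 ≡ a + a
*2≡+ a = trans (*-comm a 2) (cong (a +_) (+-identityʳ a))

odd⇒2M+1 : ∀ n → n % 2 ≡ 1 → n ≡ suc ((n ∸ 1) / 2 + (n ∸ 1) / 2)
odd⇒2M+1 n odd = begin
  n                                   ≡⟨ n≡1+2h ⟩
  suc (h * 2)                         ≡⟨ cong suc (*2≡+ h) ⟩
  suc (h + h)                         ≡⟨ cong (λ z → suc (z + z)) half≡h ⟨
  suc ((n ∸ 1) / 2 + (n ∸ 1) / 2)     ∎
  where
  h : ℕ
  h = n / 2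
  n≡1+2h : n ≡ suc (h * 2)
  n≡1+2h = trans (m≡m%n+[m/n]*n n 2) (cong (_+ h * 2) odd)
  half≡h : (n ∸ 1) / 2 ≡ h
  half≡h = trans (cong (λ z → (z ∸ 1) / 2) n≡1+2h) (m*n/n≡m h 2)

half-minus-one : ∀ n M → 3 ≤ n → n ≡ suc (M + M) → (n ∸ 3) / 2 + 1 ≡ M
half-minus-one (suc zero) zero (s≤s ()) _
half-minus-one (suc (suc _)) zero _ ()
half-minus-one _ (suc M) _ refl = begin
  (suc M + suc M ∸ 2) / 2 + 1   ≡⟨ cong (λ z → (z ∸ 1) / 2 + 1) (+-suc M M) ⟩
  (M + M) / 2 + 1               ≡⟨ cong (_+ 1) (trans (cong (_/ 2) (sym (*2≡+ M))) (m*n/n≡m M 2)) ⟩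
  M + 1                         ≡⟨ +-comm M 1 ⟩
  suc M                         ∎

module OddDihedral (n : ℕ) .{{_ : NonZero n}} (3≤n : 3 ≤ n) (odd : n % 2 ≡ 1) where

  M : ℕ
  M = (n ∸ 1) / 2

  n≡2M+1 : n ≡ suc (M + M)
  n≡2M+1 = odd⇒2M+1 n odd

  open CayleyDihedral n n≡2M+1 using (Γ; Γ-loopless; Γ-out; Γ-in; Γ-square)

  module _ (L j : ℕ) (ρ : Fin L → Fin L → Fin 2 → Bool)
    (ρ-irrefl : ∀ r c → ρ r r c ≡ false)
    (ρ-unique : ∀ r s → r ≢ s → ∑[ c < 2 ] ind (ρ r s c) ≡ 1)
    (ρ-in : ∀ s c → ∑[ r < L ] ind (ρ r s c) ≡ j)
    (ρ-out : ∀ r c → ∑[ s < L ] ind (ρ r s c) ≡ j) where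

    open Layered n M n≡2M+1 Γ Γ-loopless Γ-out Γ-in Γ-square L j ρ ρ-irrefl ρ-unique ρ-in ρ-out
      using (vertices; JA; squareRegular)

    layeredSquareRegular : SquareRegular vertices JA (2 * j * n + n ∸ 1) (j * n + M)
    layeredSquareRegular = subst₂ (SquareRegular vertices JA) degree μ-value squareRegular
      where
      μ-value : M + n * j ≡ j * n + M
      μ-value = trans (+-comm M (n * j)) (cong (_+ M) (*-comm n j))
      degree : 2 * M + n * (2 * j) ≡ 2 * j * n + n ∸ 1
      degree = sym (begin
        2 * j * n + n ∸ 1              ≡⟨ cong (λ z → 2 * j * n + z ∸ 1) n≡2M+1 ⟩
        2 * j * n + suc (M + M) ∸ 1    ≡⟨ cong (_∸ 1) (+-suc (2 * j * n) (M + M)) ⟩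
        2 * j * n + (M + M)            ≡⟨ solve 3 (λ j n M → con 2 :* j :* n :+ (M :+ M) := con 2 :* M :+ n :* (con 2 :* j)) refl j n M ⟩
        2 * M + n * (2 * j)            ∎)

  λ+1≡μ : ∀ j → j * n + (n ∸ 3) / 2 + 1 ≡ j * n + M
  λ+1≡μ j = trans (+-assoc (j * n) ((n ∸ 3) / 2) 1) (cong (j * n +_) (half-minus-one n M 3≤n n≡2M+1))

  cell-size : ∀ i → countL (dihElems n) (λ v → toℕ (piDih n v) ≡ᵇ toℕ i) ≡ n
  cell-size i = begin
    countL (dihElems n) (λ v → toℕ (piDih n v) ≡ᵇ toℕ i)  ≡⟨ countL-dih n (λ v → toℕ (piDih n v) ≡ᵇ toℕ i) ⟩
    ΣV n (λ v → δ (proj₁ v) i)                             ≡⟨ ΣV-cell n (λ c → δ c i) ⟩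
    n * ∑[ c < 2 ] δ c i                                   ≡⟨ cong (n *_) (trans (sum-cong-≗ (λ c → sym (*-identityʳ (δ c i)))) (sum-delta′ i (λ _ → 1))) ⟩
    n * 1                                                  ≡⟨ *-identityʳ n ⟩
    n                                                      ∎

  -- π is homogeneous, and Γ^1_π is the layered digraph on three layers
  goodPartition : IsGoodPartition (dihElems n) Γ 2 (piDih n)
  goodPartition = (λ i → subst (1 ≤_) (sym (cell-size i)) (≤-trans (s≤s z≤n) 3≤n))
    , (λ i i′ → trans (cell-size i) (sym (cell-size i′)))
    , _ , _ , _ , _ , _ , squareRegular⇒DSRG refl (λ+1≡μ 1)
        (layeredSquareRegular 3 1 joinCross JoinLayers.ρ-irrefl JoinLayers.ρ-unique JoinLayers.ρ-in JoinLayers.ρ-out)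

  -- 2j + 1 parity layers, relabelled by positions in Fin ((4j + 2)n)
  layeredDSRG : ∀ j → ExistsDSRG ((4 * j + 2) * n) (2 * j * n + n ∸ 1) (j * n + (n ∸ 1) / 2)
    (j * n + (n ∸ 3) / 2) (j * n + (n ∸ 1) / 2)
  layeredDSRG j = _ , _ , squareRegular⇒DSRG order (λ+1≡μ j) (squareRegular-positions vertices
    (layeredSquareRegular (suc (j + j)) j ρ ρ-irrefl ρ-unique ρ-in ρ-out))
    where
    open ParityLayers j
    vertices : List (Dih n × Fin (suc (j + j)))
    vertices = prodList (dihElems n) (allFin (suc (j + j)))
    length-allFin : ∀ k → length (allFin k) ≡ k
    length-allFin k = length-tabulate (λ i → i)
    order : length (allFin (length vertices)) ≡ (4 * j + 2) * n
    order = begin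
      length (allFin (length vertices))                   ≡⟨ length-allFin (length vertices) ⟩
      length vertices                                     ≡⟨ length-prod (dihElems n) (allFin (suc (j + j))) ⟩
      length (dihElems n) * length (allFin (suc (j + j))) ≡⟨ cong₂ _*_ (length-prod (allFin 2) (allFin n)) (length-allFin (suc (j + j))) ⟩
      length (allFin 2) * length (allFin n) * suc (j + j) ≡⟨ cong₂ (λ a b → a * b * suc (j + j)) (length-allFin 2) (length-allFin n) ⟩
      2 * n * suc (j + j)                                 ≡⟨ solve 2 (λ n j → con 2 :* n :* (con 1 :+ (j :+ j)) := (con 4 :* j :+ con 2) :* n) refl n j ⟩
      (4 * j + 2) * n                                     ∎

mainTheorem17 : (n j : ℕ) .{{_ : NonZero n}} → 3 ≤ n → n % 2 ≡ 1 → 1 ≤ j →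
    IsGoodPartition (dihElems n) (GammaDih n) 2 (piDih n) ×
    ExistsDSRG ((4 * j + 2) * n) (2 * j * n + n ∸ 1) (j * n + (n ∸ 1) / 2)
      (j * n + (n ∸ 3) / 2) (j * n + (n ∸ 1) / 2)
mainTheorem17 n j 3≤n odd _ = goodPartition , layeredDSRG j
  where open OddDihedral n 3≤n odd
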